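{- Let $q$ be a power of $2$ with $q \ge 8$. Then in $PG(2,q)$ there exists an untouchable set of size $2q-1$. Moreover, if $q$ is an even power of $2$, there exists an untouchable set of size $2q-2$ in $PG(2,q)$.
   Context: $PG(2,q)$ is the Desarguesian projective plane over the finite field $GF(q)$. An untouchable set in a projective plane is a set of points such that no line of the plane meets the set in exactly one point. -}

module Defs where

open import Level using (Level; _⊔_)
open import Data.Nat using (ℕ; _^_)
open import Data.Fin using (Fin)
open import Data.Product using (Σ; _×_; ∃; ∃-syntax; _,_)
open import Data.List using (List; length)
open import Data.List.Membership.Propositional using (_∈_)
open import Data.List.Relation.Unary.AllPairs using (AllPairs)
open import Relation.Nullary using (¬_)
open import Relation.Binary.PropositionalEquality using (_≡_)
open import Algebra.Bundles using (CommutativeRing)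

record IsField {c ℓ : Level} (R : CommutativeRing c ℓ) : Set (c ⊔ ℓ) where
  open CommutativeRing R
  field
    0≉1 : ¬ (0# ≈ 1#)
    inverse : ∀ x → ¬ (x ≈ 0#) → Σ Carrier (λ y → x * y ≈ 1#)

record HasOrder {c ℓ : Level} (R : CommutativeRing c ℓ) (q : ℕ) : Set (c ⊔ ℓ) where
  open CommutativeRing R
  field
    enum : Fin q → Carrier
    enum-injective : ∀ i j → enum i ≈ enum j → i ≡ j
    enum-surjective : ∀ x → Σ (Fin q) (λ i → enum i ≈ x)

-- Homogeneous coordinates for PG(2,F): triples over F.
module Plane {c ℓ : Level} (R : CommutativeRing c ℓ) where
  open CommutativeRing R

  record Vec3 : Set c where
    constructor ⟨_,_,_⟩
    field
      x₀ x₁ x₂ : Carrier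

  open Vec3 public

  -- a nonzero triple (represents a point, or dually a line, of PG(2,F))
  NonZero3 : Vec3 → Set ℓ
  NonZero3 v = ¬ ((x₀ v ≈ 0#) × (x₁ v ≈ 0#) × (x₂ v ≈ 0#))

  Proportional : Vec3 → Vec3 → Set (c ⊔ ℓ)
  Proportional u v = ∃[ t ] ((x₀ u ≈ t * x₀ v) × (x₁ u ≈ t * x₁ v) × (x₂ u ≈ t * x₂ v))

  Incident : Vec3 → Vec3 → Set ℓ
  Incident l v = (x₀ l * x₀ v + x₁ l * x₁ v + x₂ l * x₂ v) ≈ 0#

  record PointSet (n : ℕ) : Set (c ⊔ ℓ) where
    field
      pts : List Vec3
      size : length pts ≡ n
      nonzero : ∀ {v} → v ∈ pts → NonZero3 v
      distinct : AllPairs (λ u v → ¬ Proportional u v) pts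

  -- Untouchable: no line meets the set in exactly one point, i.e. whenever a
  -- line l meets the set in a point u, it meets it in another point v.
  Untouchable : ∀ {n} → PointSet n → Set (c ⊔ ℓ)
  Untouchable S =
    ∀ (l : Vec3) → NonZero3 l →
    ∀ {u} → u ∈ PointSet.pts S → Incident l u →
    ∃[ v ] (v ∈ PointSet.pts S × Incident l v × ¬ Proportional u v)

-- In characteristic 2 the conic x₁² = x₀x₂ together with its nucleus (0, 1, 0) is a hyperoval H: every
-- line meets it in 0 or 2 points.  Untouchability is preserved by collineations and by unions, so
-- H ∪ M(H) is untouchable for the collineation M(x₀, x₁, x₂) = (a x₀ + x₁, (1 + a) x₁, a x₁ + x₂),
-- a ∉ {0, 1}.  The two hyperovals share exactly (0, 0, 1), (0, 1, 0) and the conic points with parameter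
-- 0, 1 and a, together with (1, 1 + a, a) when a² + a + 1 = 0.  Hence |H ∪ M(H)| = 2(q + 2) − 5 = 2q − 1
-- for a generic a, which exists once q ≥ 5, and 2q − 2 when a is a primitive cube root of unity, which
-- exists when 3 ∣ q − 1, i.e. when q is an even power of 2.  Characteristic 2, square roots and the cube
-- root of unity all come from counting in the finite field.
module Submission where

open import Level using (Level; _⊔_)
open import Function using (_∘′_)
open import Algebra.Bundles using (CommutativeRing)
import Algebra.Properties.Group as GroupProperties
import Algebra.Properties.Ring as RingProperties
import Algebra.Solver.Ring.NaturalCoefficients.Default as NaturalCoefficientsSolver
import Data.Nat as Nat
open Nat using (ℕ; zero; suc; _∸_; _^_; _≤_; _<_; s≤s; z≤n)
import Data.Nat.Properties as ℕₚ
open import Data.Nat.Divisibility using (_∣_; divides; _∣0; ∣-refl; ∣1⇒≡1; ∣m∣n⇒∣m+n; ∣m+n∣m⇒∣n; m∣m*n)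
open import Data.Nat.Induction using (<-wellFounded)
import Data.Nat.Solver as ℕSolver
import Data.Fin.Properties as Fin
open import Data.List using (List; []; _∷_; length; map; filter; tabulate; _++_)
open import Data.List.Properties using (filter-notAll; length-++; length-map; length-tabulate)
open import Data.List.Relation.Unary.Any as Any using (Any; here; there)
open import Data.List.Relation.Unary.All as All using ([]; _∷_)
import Data.List.Relation.Unary.All.Properties as All
open import Data.List.Relation.Unary.AllPairs as AllPairs using (AllPairs; []; _∷_)
import Data.List.Relation.Unary.AllPairs.Properties as AllPairs
import Data.List.Relation.Unary.Unique.Setoid as UniqueSetoid
import Data.List.Relation.Unary.Unique.Setoid.Properties as Uniqueₚ
import Data.List.Membership.Setoid as SetoidMembership
import Data.List.Membership.Setoid.Properties as SetoidMembershipₚ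
import Data.List.Membership.Propositional as Membership
import Data.List.Membership.Propositional.Properties as Membershipₚ
import Data.List.Relation.Binary.Subset.Setoid as SetoidSubset
open import Data.Product using (_×_; _,_; proj₁; proj₂; ∃; ∃-syntax)
open import Data.Sum using (_⊎_; inj₁; inj₂; [_,_]′)
open import Induction.WellFounded using (Acc; acc)
open import Relation.Nullary using (¬_; Dec; yes; no; ¬?; contradiction)
import Relation.Nullary.Decidable as Dec
open import Relation.Unary using (Pred; ∁; _∪_)
import Relation.Unary as U
open import Relation.Unary.Properties using (∁?)
open import Relation.Binary using (Setoid; Decidable)
import Relation.Binary.Reasoning.Setoid as SetoidReasoning
open import Relation.Binary.PropositionalEquality as ≡ using (_≡_)
open import Defs

module _ where
  open Nat using (_+_; _*_)
  open ℕₚ using (+-comm; *-comm; *-suc; m+n∸n≡m)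
  open ℕSolver.+-*-Solver using (solve; _:=_; _:+_; _:*_; con)
  open ≡.≡-Reasoning

  ∣n∧∣1+n⇒≡1 : ∀ {d n} → d ∣ n → d ∣ suc n → d ≡ 1
  ∣n∧∣1+n⇒≡1 {d} {n} d∣n d∣1+n = ∣1⇒≡1 (∣m+n∣m⇒∣n (≡.subst (d ∣_) (+-comm 1 n) d∣1+n) d∣n)

  2∣2^k : ∀ {k} → 1 ≤ k → 2 ∣ 2 ^ k
  2∣2^k {suc k} _ = m∣m*n (2 ^ k)

  4^m≡1+3t : ∀ m → ∃[ t ] 2 ^ (2 * m) ≡ 1 + 3 * t
  4^m≡1+3t zero = 0 , ≡.refl
  4^m≡1+3t (suc m) = let t , 4^m≡1+3t = 4^m≡1+3t m in 1 + 4 * t , (begin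
    2 ^ (2 * suc m)         ≡⟨ ≡.cong (2 ^_) (*-suc 2 m) ⟩
    2 * (2 * 2 ^ (2 * m))   ≡⟨ ≡.cong (λ n → 2 * (2 * n)) 4^m≡1+3t ⟩
    2 * (2 * (1 + 3 * t))   ≡⟨ solve 1 (λ t → con 2 :* (con 2 :* (con 1 :+ con 3 :* t))
                                             := con 1 :+ con 3 :* (con 1 :+ con 4 :* t)) ≡.refl t ⟩
    1 + 3 * (1 + 4 * t)     ∎)

  3∣4^m∸1 : ∀ m → 3 ∣ 2 ^ (2 * m) ∸ 1
  3∣4^m∸1 m = let t , 4^m≡1+3t = 4^m≡1+3t m in divides t (≡.trans (≡.cong (_∸ 1) 4^m≡1+3t) (*-comm 3 t))

  doubling-size : ∀ {n e u d} → n ≡ 2 + e + u → u + (2 + d) ≡ e → n ≡ 2 * e ∸ d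
  doubling-size {n} {e} {u} {d} n≡2+e+u u+2+d≡e = begin
    n           ≡⟨ m+n∸n≡m n d ⟨
    n + d ∸ d   ≡⟨ ≡.cong (_∸ d) n+d≡2e ⟩
    2 * e ∸ d   ∎
    where
      n+d≡2e : n + d ≡ 2 * e
      n+d≡2e = begin
        n + d               ≡⟨ ≡.cong (_+ d) n≡2+e+u ⟩
        2 + e + u + d       ≡⟨ solve 3 (λ e u d → con 2 :+ e :+ u :+ d := e :+ (u :+ (con 2 :+ d))) ≡.refl e u d ⟩
        e + (u + (2 + d))   ≡⟨ ≡.cong (e +_) u+2+d≡e ⟩
        e + e               ≡⟨ solve 1 (λ e → e :+ e := con 2 :* e) ≡.refl e ⟩
        2 * e               ∎

  length-filter-∁ : ∀ {a p} {A : Set a} {P : Pred A p} (P? : U.Decidable P) (xs : List A) →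
                    length (filter P? xs) + length (filter (∁? P?) xs) ≡ length xs
  length-filter-∁ P? [] = ≡.refl
  length-filter-∁ P? (x ∷ xs) with P? x
  ... | yes _ = ≡.cong suc (length-filter-∁ P? xs)
  ... | no _ = ≡.trans (ℕₚ.+-suc _ _) (≡.cong suc (length-filter-∁ P? xs))

module FiniteCounting {a ℓ} (S : Setoid a ℓ) (_≟_ : Decidable (Setoid._≈_ S)) where
  open Setoid S renaming (Carrier to A)
  open Nat using (_+_)
  open SetoidMembership S using (_∈_; _∉_)
  open SetoidMembershipₚ using (∈-resp-≈; ∉-resp-≈; ∈-filter⁺; ∈-filter⁻; All[≉]⇒∉)
  open UniqueSetoid S using (Unique)
  open SetoidSubset S using (_⊆_)

  _∈?_ : ∀ x xs → Dec (x ∈ xs)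
  x ∈? xs = Any.any? (x ≟_) xs

  _∉?_ : ∀ x xs → Dec (x ∉ xs)
  x ∉? xs = ¬? (x ∈? xs)

  unique-⊆⇒length≤ : ∀ {xs ys} → Unique xs → xs ⊆ ys → length xs ≤ length ys
  unique-⊆⇒length≤ {[]} _ _ = z≤n
  unique-⊆⇒length≤ {x ∷ xs} {ys} (x≉xs ∷ xs!) x∷xs⊆ys =
    ℕₚ.≤-trans (s≤s (unique-⊆⇒length≤ xs! xs⊆ys-x)) (filter-notAll (x ≉?_) ys x∈ys)
    where
      _≉?_ : ∀ x y → Dec (¬ x ≈ y)
      x ≉? y = ¬? (x ≟ y)
      x∈ys : Any (∁ (λ y → ¬ x ≈ y)) ys
      x∈ys = Any.map (λ x≈y x≉y → x≉y x≈y) (x∷xs⊆ys (here refl))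
      xs⊆ys-x : xs ⊆ filter (x ≉?_) ys
      xs⊆ys-x y∈xs = ∈-filter⁺ S (x ≉?_) (λ y≈z x≉y x≈z → x≉y (trans x≈z (sym y≈z)))
        (x∷xs⊆ys (there y∈xs)) (λ x≈y → All[≉]⇒∉ S x≉xs (∈-resp-≈ S (sym x≈y) y∈xs))

  length-filter-∈ : ∀ {xs ys} → Unique xs → Unique ys → ys ⊆ xs → length (filter (_∈? ys) xs) ≡ length ys
  length-filter-∈ {xs} {ys} xs! ys! ys⊆xs = ℕₚ.≤-antisym
    (unique-⊆⇒length≤ (Uniqueₚ.filter⁺ S (_∈? ys) xs!) (proj₂ ∘′ ∈-filter⁻ S (_∈? ys) (∈-resp-≈ S) {xs = xs}))
    (unique-⊆⇒length≤ ys! (λ v∈ys → ∈-filter⁺ S (_∈? ys) (∈-resp-≈ S) (ys⊆xs v∈ys) v∈ys))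

  infixl 5 _∖_
  _∖_ : List A → List A → List A
  xs ∖ ys = filter (_∉? ys) xs

  ∈-∖⁺ : ∀ {x xs ys} → x ∈ xs → x ∉ ys → x ∈ xs ∖ ys
  ∈-∖⁺ = ∈-filter⁺ S (_∉? _) (∉-resp-≈ S)

  ∈-∖⁻ : ∀ xs ys {x} → x ∈ xs ∖ ys → x ∈ xs × x ∉ ys
  ∈-∖⁻ xs ys = ∈-filter⁻ S (_∉? ys) (∉-resp-≈ S) {xs = xs}

  ∖-unique : ∀ {xs} ys → Unique xs → Unique (xs ∖ ys)
  ∖-unique ys = Uniqueₚ.filter⁺ S (_∉? ys)

  length-∖ : ∀ {xs ys} → Unique xs → Unique ys → ys ⊆ xs → length (xs ∖ ys) + length ys ≡ length xs
  length-∖ {xs} {ys} xs! ys! ys⊆xs = begin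
    length (xs ∖ ys) + length ys
      ≡⟨ ℕₚ.+-comm _ (length ys) ⟩
    length ys + length (xs ∖ ys)
      ≡⟨ ≡.cong (_+ length (xs ∖ ys)) (length-filter-∈ xs! ys! ys⊆xs) ⟨
    length (filter (_∈? ys) xs) + length (filter (_∉? ys) xs)
      ≡⟨ length-filter-∁ (_∈? ys) xs ⟩
    length xs ∎
    where open ≡.≡-Reasoning

  module Orbits (p : ℕ) (orbit : A → List A) (xs : List A)
    (∈-orbit : ∀ x → x ∈ orbit x)
    (orbit-unique : ∀ {x} → x ∈ xs → Unique (orbit x))
    (orbit-length : ∀ {x} → x ∈ xs → length (orbit x) ≡ p)
    (orbit-sym : ∀ {x y} → x ∈ xs → y ∈ orbit x → x ∈ orbit y)
    (orbit-trans : ∀ {x y} → x ∈ xs → y ∈ orbit x → orbit y ⊆ orbit x)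
    where

    Closed : List A → Set (a ⊔ ℓ)
    Closed ys = ∀ {y} → y ∈ ys → orbit y ⊆ ys

    p∣length : Unique xs → Closed xs → p ∣ length xs
    p∣length xs! closed = p∣closed xs (<-wellFounded (length xs)) xs! (λ x∈ → x∈) closed
      where
        p∣closed : ∀ ys → Acc _<_ (length ys) → Unique ys → ys ⊆ xs → Closed ys → p ∣ length ys
        p∣closed [] _ _ _ _ = p ∣0
        p∣closed ys@(y ∷ _) (acc shorter) ys! ys⊆xs closed =
          ≡.subst (p ∣_) rest+orbit≡ys (∣m∣n⇒∣m+n p∣rest (≡.subst (p ∣_) (≡.sym (orbit-length y∈xs)) ∣-refl))
          where
            y∈xs : y ∈ xs
            y∈xs = ys⊆xs (here refl)
            rest : List A
            rest = ys ∖ orbit y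
            rest+orbit≡ys : length rest + length (orbit y) ≡ length ys
            rest+orbit≡ys = length-∖ ys! (orbit-unique y∈xs) (closed (here refl))
            rest-closed : Closed rest
            rest-closed z∈rest w∈orbit-z =
              let z∈ys , z∉orbit-y = ∈-∖⁻ ys (orbit y) z∈rest
              in ∈-∖⁺ (closed z∈ys w∈orbit-z)
                      (λ w∈orbit-y → z∉orbit-y (orbit-trans y∈xs w∈orbit-y (orbit-sym (ys⊆xs z∈ys) w∈orbit-z)))
            p∣rest : p ∣ length rest
            p∣rest = p∣closed rest (shorter (filter-notAll (_∉? orbit y) ys (here (λ y∉ → y∉ (∈-orbit y)))))
              (∖-unique (orbit y) ys!) (λ z∈rest → ys⊆xs (proj₁ (∈-∖⁻ ys (orbit y) z∈rest))) rest-closed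

  module _ (g : A → A) (g-cong : ∀ {x y} → x ≈ y → g x ≈ g y) {xs : List A} (xs! : Unique xs)
           (g-closed : ∀ {x} → x ∈ xs → g x ∈ xs) (g-fixedPointFree : ∀ {x} → x ∈ xs → ¬ x ≈ g x) where

    fixedPointFree-involution⇒2∣length : (∀ {x} → x ∈ xs → g (g x) ≈ x) → 2 ∣ length xs
    fixedPointFree-involution⇒2∣length g²≈id = p∣length xs! closed
      where
        orbit : A → List A
        orbit x = x ∷ g x ∷ []
        g-∈-orbit : ∀ {x y} → x ∈ xs → y ∈ orbit x → g y ∈ orbit x
        g-∈-orbit x∈ (here y≈x) = there (here (g-cong y≈x))
        g-∈-orbit x∈ (there (here y≈gx)) = here (trans (g-cong y≈gx) (g²≈id x∈))
        orbit-sym : ∀ {x y} → x ∈ xs → y ∈ orbit x → x ∈ orbit y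
        orbit-sym x∈ (here y≈x) = here (sym y≈x)
        orbit-sym x∈ (there (here y≈gx)) = there (here (sym (trans (g-cong y≈gx) (g²≈id x∈))))
        orbit-trans : ∀ {x y} → x ∈ xs → y ∈ orbit x → orbit y ⊆ orbit x
        orbit-trans x∈ y∈ (here z≈y) = ∈-resp-≈ S (sym z≈y) y∈
        orbit-trans x∈ y∈ (there (here z≈gy)) = ∈-resp-≈ S (sym z≈gy) (g-∈-orbit x∈ y∈)
        orbit-unique : ∀ {x} → x ∈ xs → Unique (orbit x)
        orbit-unique x∈ = (g-fixedPointFree x∈ ∷ []) ∷ [] ∷ []
        open Orbits 2 orbit xs (λ x → here refl) orbit-unique (λ _ → ≡.refl) orbit-sym orbit-trans
        closed : Closed xs
        closed y∈ (here z≈y) = ∈-resp-≈ S (sym z≈y) y∈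
        closed y∈ (there (here z≈gy)) = ∈-resp-≈ S (sym z≈gy) (g-closed y∈)

    fixedPointFree-order3⇒3∣length : (∀ {x} → x ∈ xs → g (g (g x)) ≈ x) → 3 ∣ length xs
    fixedPointFree-order3⇒3∣length g³≈id = p∣length xs! closed
      where
        orbit : A → List A
        orbit x = x ∷ g x ∷ g (g x) ∷ []
        g-∈-orbit : ∀ {x y} → x ∈ xs → y ∈ orbit x → g y ∈ orbit x
        g-∈-orbit x∈ (here y≈x) = there (here (g-cong y≈x))
        g-∈-orbit x∈ (there (here y≈gx)) = there (there (here (g-cong y≈gx)))
        g-∈-orbit x∈ (there (there (here y≈g²x))) = here (trans (g-cong y≈g²x) (g³≈id x∈))
        orbit-sym : ∀ {x y} → x ∈ xs → y ∈ orbit x → x ∈ orbit y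
        orbit-sym x∈ (here y≈x) = here (sym y≈x)
        orbit-sym x∈ (there (here y≈gx)) = there (there (here (sym (trans (g-cong (g-cong y≈gx)) (g³≈id x∈)))))
        orbit-sym x∈ (there (there (here y≈g²x))) = there (here (sym (trans (g-cong y≈g²x) (g³≈id x∈))))
        orbit-trans : ∀ {x y} → x ∈ xs → y ∈ orbit x → orbit y ⊆ orbit x
        orbit-trans x∈ y∈ (here z≈y) = ∈-resp-≈ S (sym z≈y) y∈
        orbit-trans x∈ y∈ (there (here z≈gy)) = ∈-resp-≈ S (sym z≈gy) (g-∈-orbit x∈ y∈)
        orbit-trans x∈ y∈ (there (there (here z≈g²y))) = ∈-resp-≈ S (sym z≈g²y) (g-∈-orbit x∈ (g-∈-orbit x∈ y∈))
        orbit-unique : ∀ {x} → x ∈ xs → Unique (orbit x)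
        orbit-unique {x} x∈ = (x≉gx ∷ x≉g²x ∷ []) ∷ (g-fixedPointFree (g-closed x∈) ∷ []) ∷ [] ∷ []
          where
            x≉gx : ¬ x ≈ g x
            x≉gx = g-fixedPointFree x∈
            x≉g²x : ¬ x ≈ g (g x)
            x≉g²x x≈g²x = x≉gx (sym (trans (g-cong x≈g²x) (g³≈id x∈)))
        open Orbits 3 orbit xs (λ x → here refl) orbit-unique (λ _ → ≡.refl) orbit-sym orbit-trans
        closed : Closed xs
        closed y∈ (here z≈y) = ∈-resp-≈ S (sym z≈y) y∈
        closed y∈ (there (here z≈gy)) = ∈-resp-≈ S (sym z≈gy) (g-closed y∈)
        closed y∈ (there (there (here z≈g²y))) = ∈-resp-≈ S (sym z≈g²y) (g-closed (g-closed y∈))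

module FieldTheory {c ℓ} (F : CommutativeRing c ℓ) (isField : IsField F)
                   (_≟_ : Decidable (CommutativeRing._≈_ F)) where
  open CommutativeRing F
  open IsField isField
  open NaturalCoefficientsSolver commutativeSemiring using (solve; _:=_; _:+_; _:*_; con)
  open SetoidReasoning setoid
  open GroupProperties +-group using (inverseʳ-unique; ∙-cancelˡ; ∙-cancelʳ)

  1≉0 : ¬ 1# ≈ 0#
  1≉0 1≈0 = 0≉1 (sym 1≈0)

  -- The junk value 0# ⁻¹ = 0# makes _⁻¹ a total congruence.
  _⁻¹ : Carrier → Carrier
  x ⁻¹ with x ≟ 0#
  ... | yes _ = 0#
  ... | no x≉0 = proj₁ (inverse x x≉0)

  *-inverseʳ : ∀ {x} → ¬ x ≈ 0# → x * x ⁻¹ ≈ 1#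
  *-inverseʳ {x} x≉0 with x ≟ 0#
  ... | yes x≈0 = contradiction x≈0 x≉0
  ... | no x≉0 = proj₂ (inverse x x≉0)

  *-cancelˡ : ∀ {k x y} → ¬ k ≈ 0# → k * x ≈ k * y → x ≈ y
  *-cancelˡ {k} {x} {y} k≉0 kx≈ky = begin
    x                 ≈⟨ sym (*-identityˡ x) ⟩
    1# * x            ≈⟨ *-congʳ (sym (*-inverseʳ k≉0)) ⟩
    (k * k ⁻¹) * x    ≈⟨ solve 3 (λ k i x → (k :* i) :* x := i :* (k :* x)) refl k (k ⁻¹) x ⟩
    k ⁻¹ * (k * x)    ≈⟨ *-congˡ kx≈ky ⟩
    k ⁻¹ * (k * y)    ≈⟨ solve 3 (λ k i y → i :* (k :* y) := (k :* i) :* y) refl k (k ⁻¹) y ⟩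
    (k * k ⁻¹) * y    ≈⟨ *-congʳ (*-inverseʳ k≉0) ⟩
    1# * y            ≈⟨ *-identityˡ y ⟩
    y                 ∎

  x*y≈0⇒x≈0⊎y≈0 : ∀ {x y} → x * y ≈ 0# → x ≈ 0# ⊎ y ≈ 0#
  x*y≈0⇒x≈0⊎y≈0 {x} {y} xy≈0 with x ≟ 0#
  ... | yes x≈0 = inj₁ x≈0
  ... | no x≉0 = inj₂ (*-cancelˡ x≉0 (trans xy≈0 (sym (zeroʳ x))))

  inverse-unique : ∀ {x y} → ¬ x ≈ 0# → x * y ≈ 1# → y ≈ x ⁻¹
  inverse-unique x≉0 xy≈1 = *-cancelˡ x≉0 (trans xy≈1 (sym (*-inverseʳ x≉0)))

  ⁻¹-cong : ∀ {x y} → x ≈ y → x ⁻¹ ≈ y ⁻¹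
  ⁻¹-cong {x} {y} x≈y with x ≟ 0# | y ≟ 0#
  ... | yes _ | yes _ = refl
  ... | yes x≈0 | no y≉0 = contradiction (trans (sym x≈y) x≈0) y≉0
  ... | no x≉0 | yes y≈0 = contradiction (trans x≈y y≈0) x≉0
  ... | no x≉0 | no y≉0 =
    *-cancelˡ y≉0 (trans (*-congʳ (sym x≈y)) (trans (proj₂ (inverse x x≉0)) (sym (proj₂ (inverse y y≉0)))))

  infixl 7 _/_
  _/_ : Carrier → Carrier → Carrier
  x / y = x * y ⁻¹

  x*[y/x]≈y : ∀ {x} y → ¬ x ≈ 0# → x * (y / x) ≈ y
  x*[y/x]≈y {x} y x≉0 = begin
    x * (y * x ⁻¹) ≈⟨ solve 3 (λ x y i → x :* (y :* i) := y :* (x :* i)) refl x y (x ⁻¹) ⟩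
    y * (x * x ⁻¹) ≈⟨ *-congˡ (*-inverseʳ x≉0) ⟩
    y * 1#         ≈⟨ *-identityʳ y ⟩
    y              ∎

  +-cancelˡ-≈ : ∀ {x x' y y'} → x ≈ x' → x + y ≈ x' + y' → y ≈ y'
  +-cancelˡ-≈ {x} {x'} {y} {y'} x≈x' x+y≈x'+y' = ∙-cancelˡ x y y' (trans x+y≈x'+y' (+-congʳ (sym x≈x')))

  +-cancelʳ-≈ : ∀ {x x' y y'} → y ≈ y' → x + y ≈ x' + y' → x ≈ x'
  +-cancelʳ-≈ {x} {x'} {y} {y'} y≈y' x+y≈x'+y' = ∙-cancelʳ y x x' (trans x+y≈x'+y' (+-congˡ (sym y≈y')))

  module Characteristic2 (1+1≈0 : 1# + 1# ≈ 0#) where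

    x+x≈0 : ∀ x → x + x ≈ 0#
    x+x≈0 x = begin
      x + x         ≈⟨ solve 1 (λ x → x :+ x := (con 1 :+ con 1) :* x) refl x ⟩
      (1# + 1#) * x ≈⟨ *-congʳ 1+1≈0 ⟩
      0# * x        ≈⟨ zeroˡ x ⟩
      0#            ∎

    x+y≈0⇒x≈y : ∀ {x y} → x + y ≈ 0# → x ≈ y
    x+y≈0⇒x≈y {x} {y} x+y≈0 = trans (inverseʳ-unique x x (x+x≈0 x)) (sym (inverseʳ-unique x y x+y≈0))

    x≈y⇒x+y≈0 : ∀ {x y} → x ≈ y → x + y ≈ 0#
    x≈y⇒x+y≈0 {x} {y} x≈y = trans (+-congʳ x≈y) (x+x≈0 y)

    square-+ : ∀ x y → (x + y) * (x + y) ≈ x * x + y * y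
    square-+ x y = begin
      (x + y) * (x + y)
        ≈⟨ solve 2 (λ x y → (x :+ y) :* (x :+ y) := (x :* x :+ y :* y) :+ (x :* y :+ x :* y)) refl x y ⟩
      (x * x + y * y) + (x * y + x * y) ≈⟨ +-congˡ (x+x≈0 (x * y)) ⟩
      (x * x + y * y) + 0#            ≈⟨ +-identityʳ _ ⟩
      x * x + y * y                   ∎

    square-injective : ∀ {x y} → x * x ≈ y * y → x ≈ y
    square-injective {x} {y} x²≈y² with x*y≈0⇒x≈0⊎y≈0 (trans (square-+ x y) (x≈y⇒x+y≈0 x²≈y²))
    ... | inj₁ x+y≈0 = x+y≈0⇒x≈y x+y≈0
    ... | inj₂ x+y≈0 = x+y≈0⇒x≈y x+y≈0

    [1+x]+1≈x : ∀ x → (1# + x) + 1# ≈ x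
    [1+x]+1≈x x = begin
      (1# + x) + 1# ≈⟨ solve 1 (λ x → (con 1 :+ x) :+ con 1 := x :+ (con 1 :+ con 1)) refl x ⟩
      x + (1# + 1#) ≈⟨ +-congˡ 1+1≈0 ⟩
      x + 0#        ≈⟨ +-identityʳ x ⟩
      x             ∎

    1+x≉0 : ∀ {x} → ¬ x ≈ 1# → ¬ 1# + x ≈ 0#
    1+x≉0 x≉1 1+x≈0 = x≉1 (sym (x+y≈0⇒x≈y 1+x≈0))

    -- In characteristic 2 the roots of x² + x + 1 are exactly the primitive cube roots of unity.
    PrimitiveCubeRoot : Carrier → Set ℓ
    PrimitiveCubeRoot x = x * x + x + 1# ≈ 0#

    primitiveCubeRoot⇒≉0 : ∀ {ω} → PrimitiveCubeRoot ω → ¬ ω ≈ 0#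
    primitiveCubeRoot⇒≉0 {ω} ω³≈1 ω≈0 = 1≉0 (begin
      1#                  ≈⟨ solve 1 (λ ω → con 1 := ω :* con 0 :+ con 0 :+ con 1) refl ω ⟩
      ω * 0# + 0# + 1#    ≈⟨ +-congʳ (+-cong (*-congˡ (sym ω≈0)) (sym ω≈0)) ⟩
      ω * ω + ω + 1#      ≈⟨ ω³≈1 ⟩
      0#                  ∎)

    primitiveCubeRoot⇒≉1 : ∀ {ω} → PrimitiveCubeRoot ω → ¬ ω ≈ 1#
    primitiveCubeRoot⇒≉1 {ω} ω³≈1 ω≈1 = 1≉0 (begin
      1#                  ≈⟨ sym ([1+x]+1≈x 1#) ⟩
      1# + 1# + 1#        ≈⟨ solve 0 (con 1 :+ con 1 :+ con 1 := con 1 :* con 1 :+ con 1 :+ con 1) refl ⟩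
      1# * 1# + 1# + 1#   ≈⟨ +-congʳ (+-cong (*-cong (sym ω≈1) (sym ω≈1)) (sym ω≈1)) ⟩
      ω * ω + ω + 1#      ≈⟨ ω³≈1 ⟩
      0#                  ∎)

    square-1+x : ∀ x → (1# + x) * (1# + x) ≈ 1# + x * x
    square-1+x x = trans (square-+ 1# x) (+-congʳ (*-identityʳ 1#))

    primitiveCubeRoot⇒[1+ω]²≈ω : ∀ {ω} → PrimitiveCubeRoot ω → (1# + ω) * (1# + ω) ≈ ω
    primitiveCubeRoot⇒[1+ω]²≈ω {ω} ω³≈1 = begin
      (1# + ω) * (1# + ω) ≈⟨ square-1+x ω ⟩
      1# + ω * ω          ≈⟨ x+y≈0⇒x≈y (trans (solve 1 (λ ω → (con 1 :+ ω :* ω) :+ ω := ω :* ω :+ ω :+ con 1) refl ω)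
                                                 ω³≈1) ⟩
      ω                   ∎

    [1+x]²≈x⇒primitiveCubeRoot : ∀ {x} → (1# + x) * (1# + x) ≈ x → PrimitiveCubeRoot x
    [1+x]²≈x⇒primitiveCubeRoot {x} [1+x]²≈x = begin
      x * x + x + 1#      ≈⟨ solve 1 (λ x → x :* x :+ x :+ con 1 := (con 1 :+ x :* x) :+ x) refl x ⟩
      (1# + x * x) + x    ≈⟨ +-congʳ (trans (sym (square-1+x x)) [1+x]²≈x) ⟩
      x + x               ≈⟨ x+x≈0 x ⟩
      0#                  ∎

    primitiveCubeRoots : ∀ {ω x} → PrimitiveCubeRoot ω → PrimitiveCubeRoot x → x ≈ ω ⊎ x ≈ 1# + ω
    primitiveCubeRoots {ω} {x} ω³≈1 x³≈1 with x*y≈0⇒x≈0⊎y≈0 [x+ω][x+1+ω]≈0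
      where
        [x+ω][x+1+ω]≈0 : (x + ω) * (x + (1# + ω)) ≈ 0#
        [x+ω][x+1+ω]≈0 = begin
          (x + ω) * (x + (1# + ω))                                 ≈⟨ sym (trans (+-congˡ 1+1≈0) (+-identityʳ _)) ⟩
          (x + ω) * (x + (1# + ω)) + (1# + 1#)                      ≈⟨ solve 2 (λ x ω →
              (x :+ ω) :* (x :+ (con 1 :+ ω)) :+ (con 1 :+ con 1)
              := (x :* x :+ x :+ con 1) :+ (ω :* ω :+ ω :+ con 1) :+ (x :* ω :+ x :* ω)) refl x ω ⟩
          (x * x + x + 1#) + (ω * ω + ω + 1#) + (x * ω + x * ω)    ≈⟨ +-cong (+-cong x³≈1 ω³≈1) (x+x≈0 _) ⟩
          0# + 0# + 0#                                             ≈⟨ trans (+-identityʳ _) (+-identityʳ _) ⟩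
          0#                                                       ∎
    ... | inj₁ x+ω≈0 = inj₁ (x+y≈0⇒x≈y x+ω≈0)
    ... | inj₂ x+1+ω≈0 = inj₂ (x+y≈0⇒x≈y x+1+ω≈0)

    -- x ↦ 1/(1 + x) permutes F ∖ {0, 1} with period 3; its fixed points are the primitive cube roots.
    σ : Carrier → Carrier
    σ x = (1# + x) ⁻¹

    σ-cong : ∀ {x y} → x ≈ y → σ x ≈ σ y
    σ-cong x≈y = ⁻¹-cong (+-congˡ x≈y)

    [1+x]σx≈1 : ∀ {x} → ¬ x ≈ 1# → (1# + x) * σ x ≈ 1#
    [1+x]σx≈1 x≉1 = *-inverseʳ (1+x≉0 x≉1)

    σ≉0 : ∀ {x} → ¬ x ≈ 1# → ¬ σ x ≈ 0#
    σ≉0 x≉1 σx≈0 = 1≉0 (trans (sym ([1+x]σx≈1 x≉1)) (trans (*-congˡ σx≈0) (zeroʳ _)))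

    σ≉1 : ∀ {x} → ¬ x ≈ 0# → ¬ x ≈ 1# → ¬ σ x ≈ 1#
    σ≉1 {x} x≉0 x≉1 σx≈1 = x≉0 (begin
      x             ≈⟨ sym ([1+x]+1≈x x) ⟩
      (1# + x) + 1# ≈⟨ +-congʳ (trans (sym (*-identityʳ _)) (trans (*-congˡ (sym σx≈1)) ([1+x]σx≈1 x≉1))) ⟩
      1# + 1#       ≈⟨ 1+1≈0 ⟩
      0#            ∎)

    σ³≈id : ∀ {x} → ¬ x ≈ 0# → ¬ x ≈ 1# → σ (σ (σ x)) ≈ x
    σ³≈id {x} x≉0 x≉1 = sym (inverse-unique (1+x≉0 (σ≉1 (σ≉0 x≉1) (σ≉1 x≉0 x≉1))) [1+σ²x]x≈1)
      where
        σ²x≈[1+x]/x : σ (σ x) ≈ (1# + x) / x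
        σ²x≈[1+x]/x = sym (inverse-unique (1+x≉0 (σ≉1 x≉0 x≉1)) (begin
          (1# + σ x) * ((1# + x) * x ⁻¹)
            ≈⟨ solve 3 (λ y x i → (con 1 :+ y) :* ((con 1 :+ x) :* i) := ((con 1 :+ x) :+ (con 1 :+ x) :* y) :* i)
                 refl (σ x) x (x ⁻¹) ⟩
          ((1# + x) + (1# + x) * σ x) * x ⁻¹ ≈⟨ *-congʳ (+-congˡ ([1+x]σx≈1 x≉1)) ⟩
          ((1# + x) + 1#) * x ⁻¹             ≈⟨ *-congʳ ([1+x]+1≈x x) ⟩
          x * x ⁻¹                           ≈⟨ *-inverseʳ x≉0 ⟩
          1#                                 ∎))
        [1+σ²x]x≈1 : (1# + σ (σ x)) * x ≈ 1#
        [1+σ²x]x≈1 = begin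
          (1# + σ (σ x)) * x                 ≈⟨ *-congʳ (+-congˡ σ²x≈[1+x]/x) ⟩
          (1# + (1# + x) * x ⁻¹) * x
            ≈⟨ solve 2 (λ x i → (con 1 :+ (con 1 :+ x) :* i) :* x := x :+ (con 1 :+ x) :* (x :* i)) refl x (x ⁻¹) ⟩
          x + (1# + x) * (x * x ⁻¹)          ≈⟨ +-congˡ (trans (*-congˡ (*-inverseʳ x≉0)) (*-identityʳ _)) ⟩
          x + (1# + x)                       ≈⟨ solve 1 (λ x → x :+ (con 1 :+ x) := (x :+ x) :+ con 1) refl x ⟩
          (x + x) + 1#                       ≈⟨ +-congʳ (x+x≈0 x) ⟩
          0# + 1#                            ≈⟨ +-identityˡ 1# ⟩
          1#                                 ∎

    σ-fixed⇒primitiveCubeRoot : ∀ {x} → ¬ x ≈ 1# → σ x ≈ x → PrimitiveCubeRoot x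
    σ-fixed⇒primitiveCubeRoot {x} x≉1 σx≈x = begin
      x * x + x + 1#     ≈⟨ solve 1 (λ x → x :* x :+ x :+ con 1 := (con 1 :+ x) :* x :+ con 1) refl x ⟩
      (1# + x) * x + 1#  ≈⟨ +-congʳ (trans (*-congˡ (sym σx≈x)) ([1+x]σx≈1 x≉1)) ⟩
      1# + 1#            ≈⟨ 1+1≈0 ⟩
      0#                 ∎

module ProjectivePlane {c ℓ} (F : CommutativeRing c ℓ) where
  open CommutativeRing F
  open Plane F
  open NaturalCoefficientsSolver commutativeSemiring using (solve; _:=_; _:+_; _:*_; con)
  open Membership using (_∈_)
  open SetoidReasoning setoid

  infix 4 _≋_ _≁_
  infixr 7 _•_
  infixl 7 _·_

  -- Incident l v unfolds to l · v ≈ 0#, and Proportional u v to ∃[ t ] u ≋ t • v.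
  _·_ : Vec3 → Vec3 → Carrier
  l · v = x₀ l * x₀ v + x₁ l * x₁ v + x₂ l * x₂ v

  _•_ : Carrier → Vec3 → Vec3
  s • v = ⟨ s * x₀ v , s * x₁ v , s * x₂ v ⟩

  _≋_ : Vec3 → Vec3 → Set ℓ
  u ≋ v = (x₀ u ≈ x₀ v) × (x₁ u ≈ x₁ v) × (x₂ u ≈ x₂ v)

  _≁_ : Vec3 → Vec3 → Set (c ⊔ ℓ)
  u ≁ v = ¬ Proportional u v

  ≋⇒proportional : ∀ {u v} → u ≋ v → Proportional u v
  ≋⇒proportional (e₀ , e₁ , e₂) =
    1# , trans e₀ (sym (*-identityˡ _)) , trans e₁ (sym (*-identityˡ _)) , trans e₂ (sym (*-identityˡ _))

  proportional-trans : ∀ {u v w} → Proportional u v → Proportional v w → Proportional u w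
  proportional-trans (s , e₀ , e₁ , e₂) (t , f₀ , f₁ , f₂) =
    s * t , scale e₀ f₀ , scale e₁ f₁ , scale e₂ f₂
    where
      scale : ∀ {x y z} → x ≈ s * y → y ≈ t * z → x ≈ (s * t) * z
      scale x≈sy y≈tz = trans x≈sy (trans (*-congˡ y≈tz) (sym (*-assoc s t _)))

  incident-proportional : ∀ {l u v} → Proportional u v → Incident l v → Incident l u
  incident-proportional {l} {u} {v} (s , e₀ , e₁ , e₂) l·v≈0 = begin
    l · u                                                    ≈⟨ +-cong (+-cong (*-congˡ e₀) (*-congˡ e₁)) (*-congˡ e₂) ⟩
    x₀ l * (s * x₀ v) + x₁ l * (s * x₁ v) + x₂ l * (s * x₂ v) ≈⟨ solve 7 (λ s a b c x y z →
                                                                 a :* (s :* x) :+ b :* (s :* y) :+ c :* (s :* z)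
                                                                 := s :* (a :* x :+ b :* y :+ c :* z))
                                                               refl s (x₀ l) (x₁ l) (x₂ l) (x₀ v) (x₁ v) (x₂ v) ⟩
    s * (l · v)                                              ≈⟨ *-congˡ l·v≈0 ⟩
    s * 0#                                                   ≈⟨ zeroʳ s ⟩
    0#                                                       ∎

  AnotherPoint : ∀ {p} → Pred Vec3 p → Vec3 → Vec3 → Set (c ⊔ ℓ ⊔ p)
  AnotherPoint P l u = ∃[ v ] (P v × Incident l v × u ≁ v)

  -- Unlike Untouchable, the line l is not required to be nonzero.
  IsUntouchable : ∀ {p} → Pred Vec3 p → Set (c ⊔ ℓ ⊔ p)
  IsUntouchable P = ∀ l {u} → P u → Incident l u → AnotherPoint P l u

  ∪-untouchable : ∀ {p q} {P : Pred Vec3 p} {Q : Pred Vec3 q} →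
                  IsUntouchable P → IsUntouchable Q → IsUntouchable (P ∪ Q)
  ∪-untouchable P-untouchable Q-untouchable l (inj₁ Pu) l·u≈0 =
    let v , Pv , l·v≈0 , u≁v = P-untouchable l Pu l·u≈0 in v , inj₁ Pv , l·v≈0 , u≁v
  ∪-untouchable P-untouchable Q-untouchable l (inj₂ Qu) l·u≈0 =
    let v , Qv , l·v≈0 , u≁v = Q-untouchable l Qu l·u≈0 in v , inj₂ Qv , l·v≈0 , u≁v

  Image : ∀ {p} → (Vec3 → Vec3) → Pred Vec3 p → Pred Vec3 (c ⊔ p)
  Image f P w = ∃[ v ] (P v × f v ≡ w)

  record Collineation : Set (c ⊔ ℓ) where
    field
      apply        : Vec3 → Vec3
      applyᵀ       : Vec3 → Vec3
      adjoint      : ∀ l v → applyᵀ l · v ≈ l · apply v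
      apply-cong   : ∀ {u v} → u ≋ v → apply u ≋ apply v
      apply-cancel : ∀ {s u v} → apply u ≋ s • apply v → u ≋ s • v

    reflects-proportional : ∀ {u v} → Proportional (apply u) (apply v) → Proportional u v
    reflects-proportional (s , Mu≋sMv) = s , apply-cancel Mu≋sMv

    preserves-nonzero : ∀ {v} → NonZero3 v → NonZero3 (apply v)
    preserves-nonzero {v} v≉0 (e₀ , e₁ , e₂) =
      let f₀ , f₁ , f₂ = apply-cancel {0#} {v} {v} (annihilated e₀ , annihilated e₁ , annihilated e₂)
      in v≉0 (trans f₀ (zeroˡ _) , trans f₁ (zeroˡ _) , trans f₂ (zeroˡ _))
      where
        annihilated : ∀ {x} → x ≈ 0# → x ≈ 0# * x
        annihilated x≈0 = trans x≈0 (sym (zeroˡ _))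

    image-untouchable : ∀ {p} {P : Pred Vec3 p} → IsUntouchable P → IsUntouchable (Image apply P)
    image-untouchable P-untouchable l (u , Pu , ≡.refl) l·Mu≈0 =
      let v , Pv , l·v≈0 , u≁v = P-untouchable (applyᵀ l) Pu (trans (adjoint l u) l·Mu≈0)
      in apply v , (v , Pv , ≡.refl) , trans (sym (adjoint l v)) l·v≈0 , u≁v ∘′ reflects-proportional

  untouchable-of-enumeration : ∀ {p n} {P : Pred Vec3 p} (S : PointSet n) → IsUntouchable P →
    (∀ {u} → u ∈ PointSet.pts S → P u) →
    (∀ {v} → P v → ∃[ w ] (w ∈ PointSet.pts S × Proportional w v)) →
    Untouchable S
  untouchable-of-enumeration S P-untouchable pts⊆P P-covered l _ u∈S l·u≈0 =
    let v , Pv , l·v≈0 , u≁v = P-untouchable l (pts⊆P u∈S) l·u≈0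
        w , w∈S , w∼v = P-covered Pv
    in w , w∈S , incident-proportional w∼v l·v≈0 , λ u∼w → u≁v (proportional-trans u∼w w∼v)

module HyperovalConstruction {c ℓ} (F : CommutativeRing c ℓ) (isField : IsField F)
  (_≟_ : Decidable (CommutativeRing._≈_ F)) where

  open CommutativeRing F
  open Plane F
  open ProjectivePlane F
  open FieldTheory F isField _≟_
  open SetoidMembership setoid using () renaming (_∈_ to _∈≈_)
  open UniqueSetoid setoid using (Unique)
  open FiniteCounting setoid _≟_ using (_∈?_; _∖_; ∈-∖⁺; ∈-∖⁻; ∖-unique)
  open Membership using (_∈_; find)
  open Membershipₚ using (∈-map⁺; ∈-map⁻; ∈-++⁺ˡ; ∈-++⁺ʳ; ∈-++⁻)
  open NaturalCoefficientsSolver commutativeSemiring using (solve; _:=_; _:+_; _:*_; con)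
  open SetoidReasoning setoid
  open GroupProperties +-group using (∙-cancelˡ)

  conicPoint : Carrier → Vec3
  conicPoint t = ⟨ 1# , t , t * t ⟩

  conicPoint∞ : Vec3
  conicPoint∞ = ⟨ 0# , 0# , 1# ⟩

  nucleus : Vec3
  nucleus = ⟨ 0# , 1# , 0# ⟩

  data OnHyperoval : Vec3 → Set c where
    on-conic   : ∀ t → OnHyperoval (conicPoint t)
    on-conic∞  : OnHyperoval conicPoint∞
    on-nucleus : OnHyperoval nucleus

  1≉s*0 : ∀ s → ¬ 1# ≈ s * 0#
  1≉s*0 s 1≈s*0 = 1≉0 (trans 1≈s*0 (zeroʳ s))

  hyperoval-nonzero : ∀ {v} → OnHyperoval v → NonZero3 v
  hyperoval-nonzero (on-conic t) (e₀ , _ , _) = 1≉0 e₀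
  hyperoval-nonzero on-conic∞ (_ , _ , e₂) = 1≉0 e₂
  hyperoval-nonzero on-nucleus (_ , e₁ , _) = 1≉0 e₁

  conicPoint-cong : ∀ {t t'} → t ≈ t' → conicPoint t ≋ conicPoint t'
  conicPoint-cong t≈t' = refl , t≈t' , *-cong t≈t' t≈t'

  rescaled : ∀ {u t₀ t} s → u ≋ s • conicPoint t₀ → t ≈ t₀ → Proportional u (conicPoint t)
  rescaled s u≋sPt₀ t≈t₀ = proportional-trans (s , u≋sPt₀) (≋⇒proportional (conicPoint-cong (sym t≈t₀)))

  multiple-of-conicPoint-x₀≈0 : ∀ {u t} → Proportional u (conicPoint t) → x₀ u ≈ 0# → x₁ u ≈ 0# × x₂ u ≈ 0#
  multiple-of-conicPoint-x₀≈0 (s , e₀ , e₁ , e₂) u₀≈0 = vanish e₁ , vanish e₂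
    where
      s≈0 : s ≈ 0#
      s≈0 = trans (sym (*-identityʳ s)) (trans (sym e₀) u₀≈0)
      vanish : ∀ {x y} → x ≈ s * y → x ≈ 0#
      vanish x≈sy = trans x≈sy (trans (*-congʳ s≈0) (zeroˡ _))

  multiple-of-conicPoint-x₀≈1 : ∀ {u t} → Proportional u (conicPoint t) → x₀ u ≈ 1# → x₁ u ≈ t × x₂ u ≈ t * t
  multiple-of-conicPoint-x₀≈1 (s , e₀ , e₁ , e₂) u₀≈1 = unscale e₁ , unscale e₂
    where
      s≈1 : s ≈ 1#
      s≈1 = trans (sym (*-identityʳ s)) (trans (sym e₀) u₀≈1)
      unscale : ∀ {x y} → x ≈ s * y → x ≈ y
      unscale x≈sy = trans x≈sy (trans (*-congʳ s≈1) (*-identityˡ _))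

  conicPoint-injective : ∀ {t t'} → Proportional (conicPoint t) (conicPoint t') → t ≈ t'
  conicPoint-injective Pt∼Pt' = proj₁ (multiple-of-conicPoint-x₀≈1 Pt∼Pt' refl)

  conicPoint≁conicPoint∞ : ∀ {t} → conicPoint t ≁ conicPoint∞
  conicPoint≁conicPoint∞ (s , e₀ , _) = 1≉s*0 s e₀

  conicPoint≁nucleus : ∀ {t} → conicPoint t ≁ nucleus
  conicPoint≁nucleus (s , e₀ , _) = 1≉s*0 s e₀

  conicPoint∞≁nucleus : conicPoint∞ ≁ nucleus
  conicPoint∞≁nucleus (s , _ , _ , e₂) = 1≉s*0 s e₂

  conicPoint∞≁conicPoint : ∀ {t} → conicPoint∞ ≁ conicPoint t
  conicPoint∞≁conicPoint P∞∼Pt = 1≉0 (proj₂ (multiple-of-conicPoint-x₀≈0 P∞∼Pt refl))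

  nucleus≁conicPoint∞ : nucleus ≁ conicPoint∞
  nucleus≁conicPoint∞ (s , _ , e₁ , _) = 1≉s*0 s e₁

  nucleus≁conicPoint : ∀ {t} → nucleus ≁ conicPoint t
  nucleus≁conicPoint N∼Pt = 1≉0 (proj₁ (multiple-of-conicPoint-x₀≈0 N∼Pt refl))

  ·-conicPoint∞ : ∀ l → l · conicPoint∞ ≈ x₂ l
  ·-conicPoint∞ ⟨ α , β , γ ⟩ = solve 3 (λ α β γ → α :* con 0 :+ β :* con 0 :+ γ :* con 1 := γ) refl α β γ

  ·-nucleus : ∀ l → l · nucleus ≈ x₁ l
  ·-nucleus ⟨ α , β , γ ⟩ = solve 3 (λ α β γ → α :* con 0 :+ β :* con 1 :+ γ :* con 0 := β) refl α β γ

  -- The parameters t of the conic points lying on the image of the hyperoval under Doubling.M for a.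
  SharedParameter : Carrier → Carrier → Set ℓ
  SharedParameter a t = t ≈ 0# ⊎ t ≈ 1# ⊎ t ≈ a ⊎ (t ≈ 1# + a × t * t ≈ a)

  module _ (1+1≈0 : 1# + 1# ≈ 0#) (√ : ∀ x → ∃[ y ] y * y ≈ x) where
    open Characteristic2 1+1≈0

    through-conic : ∀ l t → Incident l (conicPoint t) → AnotherPoint OnHyperoval l (conicPoint t)
    through-conic l t _ with x₂ l ≟ 0# | x₁ l ≟ 0#
    ... | yes γ≈0 | _ = conicPoint∞ , on-conic∞ , trans (·-conicPoint∞ l) γ≈0 , conicPoint≁conicPoint∞
    ... | no _ | yes β≈0 = nucleus , on-nucleus , trans (·-nucleus l) β≈0 , conicPoint≁nucleus
    through-conic ⟨ α , β , γ ⟩ t l·Pt≈0 | no γ≉0 | no β≉0 =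
      conicPoint (t + δ) , on-conic (t + δ) , incident , β≉0 ∘′ t∼t+δ⇒β≈0
      where
        δ : Carrier
        δ = β / γ
        γδ≈β : γ * δ ≈ β
        γδ≈β = x*[y/x]≈y β γ≉0
        -- Shifting t by δ = β/γ changes the value of the form by (γδ + β)δ + 2γtδ = 0.
        incident : α * 1# + β * (t + δ) + γ * ((t + δ) * (t + δ)) ≈ 0#
        incident = begin
          α * 1# + β * (t + δ) + γ * ((t + δ) * (t + δ))
            ≈⟨ solve 6 (λ α β γ t δ o → α :* o :+ β :* (t :+ δ) :+ γ :* ((t :+ δ) :* (t :+ δ))
                   := (α :* o :+ β :* t :+ γ :* (t :* t)) :+ (γ :* δ :+ β) :* δ :+ (γ :* t :* δ :+ γ :* t :* δ))
                 refl α β γ t δ 1# ⟩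
          (α * 1# + β * t + γ * (t * t)) + (γ * δ + β) * δ + (γ * t * δ + γ * t * δ)
            ≈⟨ +-cong (+-cong l·Pt≈0 (*-congʳ (x≈y⇒x+y≈0 γδ≈β))) (x+x≈0 _) ⟩
          0# + 0# * δ + 0#
            ≈⟨ solve 1 (λ δ → con 0 :+ con 0 :* δ :+ con 0 := con 0) refl δ ⟩
          0# ∎
        t∼t+δ⇒β≈0 : Proportional (conicPoint t) (conicPoint (t + δ)) → β ≈ 0#
        t∼t+δ⇒β≈0 t∼t+δ = begin
          β      ≈⟨ sym γδ≈β ⟩
          γ * δ  ≈⟨ *-congˡ (sym (∙-cancelˡ t 0# δ (trans (+-identityʳ t) (conicPoint-injective t∼t+δ)))) ⟩
          γ * 0# ≈⟨ zeroʳ γ ⟩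
          0#     ∎

    through-conic∞ : ∀ l → Incident l conicPoint∞ → AnotherPoint OnHyperoval l conicPoint∞
    through-conic∞ l _ with x₁ l ≟ 0#
    ... | yes β≈0 = nucleus , on-nucleus , trans (·-nucleus l) β≈0 , conicPoint∞≁nucleus
    through-conic∞ ⟨ α , β , γ ⟩ l·P∞≈0 | no β≉0 =
      conicPoint w , on-conic w , incident , conicPoint∞≁conicPoint
      where
        w : Carrier
        w = α / β
        γ≈0 : γ ≈ 0#
        γ≈0 = trans (sym (·-conicPoint∞ ⟨ α , β , γ ⟩)) l·P∞≈0
        incident : α * 1# + β * w + γ * (w * w) ≈ 0#
        incident = begin
          α * 1# + β * w + γ * (w * w) ≈⟨ +-cong (+-cong (*-identityʳ α) (x*[y/x]≈y α β≉0)) (*-congʳ γ≈0) ⟩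
          α + α + 0# * (w * w)         ≈⟨ +-cong (x+x≈0 α) (zeroˡ _) ⟩
          0# + 0#                      ≈⟨ +-identityʳ 0# ⟩
          0#                           ∎

    through-nucleus : ∀ l → Incident l nucleus → AnotherPoint OnHyperoval l nucleus
    through-nucleus l _ with x₂ l ≟ 0#
    ... | yes γ≈0 = conicPoint∞ , on-conic∞ , trans (·-conicPoint∞ l) γ≈0 , nucleus≁conicPoint∞
    through-nucleus ⟨ α , β , γ ⟩ l·N≈0 | no γ≉0 =
      conicPoint r , on-conic r , incident , nucleus≁conicPoint
      where
        r : Carrier
        r = proj₁ (√ (α / γ))
        r²≈α/γ : r * r ≈ α / γ
        r²≈α/γ = proj₂ (√ (α / γ))
        β≈0 : β ≈ 0#
        β≈0 = trans (sym (·-nucleus ⟨ α , β , γ ⟩)) l·N≈0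
        incident : α * 1# + β * r + γ * (r * r) ≈ 0#
        incident = begin
          α * 1# + β * r + γ * (r * r) ≈⟨ +-cong (+-cong (*-identityʳ α) (*-congʳ β≈0)) (*-congˡ r²≈α/γ) ⟩
          α + 0# * r + γ * (α / γ)     ≈⟨ +-cong (+-cong refl (zeroˡ r)) (x*[y/x]≈y α γ≉0) ⟩
          α + 0# + α                   ≈⟨ +-congʳ (+-identityʳ α) ⟩
          α + α                        ≈⟨ x+x≈0 α ⟩
          0#                           ∎

    hyperoval-untouchable : IsUntouchable OnHyperoval
    hyperoval-untouchable l (on-conic t) = through-conic l t
    hyperoval-untouchable l on-conic∞ = through-conic∞ l
    hyperoval-untouchable l on-nucleus = through-nucleus l

    module Doubling (a : Carrier) (a≉0 : ¬ a ≈ 0#) (a≉1 : ¬ a ≈ 1#) where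

      M : Vec3 → Vec3
      M v = ⟨ a * x₀ v + x₁ v , (1# + a) * x₁ v , a * x₁ v + x₂ v ⟩

      Mᵀ : Vec3 → Vec3
      Mᵀ l = ⟨ a * x₀ l , x₀ l + (1# + a) * x₁ l + a * x₂ l , x₂ l ⟩

      M-adjoint : ∀ l v → Mᵀ l · v ≈ l · M v
      M-adjoint l v = solve 8 (λ o a l₀ l₁ l₂ v₀ v₁ v₂ →
          (a :* l₀) :* v₀ :+ (l₀ :+ (o :+ a) :* l₁ :+ a :* l₂) :* v₁ :+ l₂ :* v₂
          := l₀ :* (a :* v₀ :+ v₁) :+ l₁ :* ((o :+ a) :* v₁) :+ l₂ :* (a :* v₁ :+ v₂))
        refl 1# a (x₀ l) (x₁ l) (x₂ l) (x₀ v) (x₁ v) (x₂ v)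

      M-cong : ∀ {u v} → u ≋ v → M u ≋ M v
      M-cong (e₀ , e₁ , e₂) = +-cong (*-congˡ e₀) e₁ , *-congˡ e₁ , +-cong (*-congˡ e₁) e₂

      M-cancel : ∀ {s u v} → M u ≋ s • M v → u ≋ s • v
      M-cancel {s} {u} {v} (e₀ , e₁ , e₂) = u₀≈sv₀ , u₁≈sv₁ , u₂≈sv₂
        where
          u₁≈sv₁ : x₁ u ≈ s * x₁ v
          u₁≈sv₁ = *-cancelˡ (1+x≉0 a≉1)
            (trans e₁ (solve 3 (λ s b y → s :* (b :* y) := b :* (s :* y)) refl s (1# + a) (x₁ v)))
          u₀≈sv₀ : x₀ u ≈ s * x₀ v
          u₀≈sv₀ = *-cancelˡ a≉0 (+-cancelʳ-≈ u₁≈sv₁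
            (trans e₀ (solve 4 (λ s a x y → s :* (a :* x :+ y) := a :* (s :* x) :+ s :* y) refl s a (x₀ v) (x₁ v))))
          u₂≈sv₂ : x₂ u ≈ s * x₂ v
          u₂≈sv₂ = +-cancelˡ-≈ (*-congˡ u₁≈sv₁)
            (trans e₂ (solve 4 (λ s a y z → s :* (a :* y :+ z) := a :* (s :* y) :+ s :* z) refl s a (x₁ v) (x₂ v)))

      collineation : Collineation
      collineation = record
        { apply = M ; applyᵀ = Mᵀ ; adjoint = M-adjoint ; apply-cong = M-cong ; apply-cancel = M-cancel }

      open Collineation collineation using (reflects-proportional; preserves-nonzero; image-untouchable)

      M-conicPoint∞ : M conicPoint∞ ≋ conicPoint∞
      M-conicPoint∞ = solve 1 (λ a → a :* con 0 :+ con 0 := con 0) refl a , zeroʳ _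
                    , solve 1 (λ a → a :* con 0 :+ con 1 := con 1) refl a

      M-nucleus : M nucleus ≋ ⟨ 1# , 1# + a , a ⟩
      M-nucleus = solve 1 (λ a → a :* con 0 :+ con 1 := con 1) refl a , *-identityʳ _
                , solve 1 (λ a → a :* con 1 :+ con 0 := a) refl a

      -- From M(1, z, z²) = s(1, t, t²) one gets s = a + z and z = t², hence t(t + 1)(t + a) = 0.
      image-of-conic-meets-conic : ∀ {z t} → Proportional (M (conicPoint z)) (conicPoint t) →
                                   t ≈ 0# ⊎ t ≈ 1# ⊎ t ≈ a
      image-of-conic-meets-conic {z} {t} (s , e₀ , e₁ , e₂) with x*y≈0⇒x≈0⊎y≈0 t[t+1][t+a]≈0
        where
          s≉0 : ¬ s ≈ 0#
          s≉0 s≈0 = preserves-nonzero (hyperoval-nonzero (on-conic z)) (vanish e₀ , vanish e₁ , vanish e₂)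
            where
              vanish : ∀ {x y} → x ≈ s * y → x ≈ 0#
              vanish x≈sy = trans x≈sy (trans (*-congʳ s≈0) (zeroˡ _))
          s≈a+z : s ≈ a + z
          s≈a+z = trans (sym (*-identityʳ s)) (trans (sym e₀) (+-congʳ (*-identityʳ a)))
          t²≈z : t * t ≈ z
          t²≈z = *-cancelˡ s≉0 (begin
            s * (t * t)   ≈⟨ sym e₂ ⟩
            a * z + z * z ≈⟨ solve 2 (λ a z → a :* z :+ z :* z := (a :+ z) :* z) refl a z ⟩
            (a + z) * z   ≈⟨ *-congʳ (sym s≈a+z) ⟩
            s * z         ∎)
          t[t+1][t+a]≈0 : t * ((t + 1#) * (t + a)) ≈ 0#
          t[t+1][t+a]≈0 = begin
            t * ((t + 1#) * (t + a))                  ≈⟨ solve 2 (λ t a → t :* ((t :+ con 1) :* (t :+ a))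
                                                           := (a :+ t :* t) :* t :+ (con 1 :+ a) :* (t :* t)) refl t a ⟩
            (a + t * t) * t + (1# + a) * (t * t)      ≈⟨ x≈y⇒x+y≈0 (begin
              (a + t * t) * t    ≈⟨ *-congʳ (trans (+-congˡ t²≈z) (sym s≈a+z)) ⟩
              s * t              ≈⟨ sym e₁ ⟩
              (1# + a) * z       ≈⟨ *-congˡ (sym t²≈z) ⟩
              (1# + a) * (t * t) ∎) ⟩
            0#                                        ∎
      ... | inj₁ t≈0 = inj₁ t≈0
      ... | inj₂ [t+1][t+a]≈0 with x*y≈0⇒x≈0⊎y≈0 [t+1][t+a]≈0
      ...   | inj₁ t+1≈0 = inj₂ (inj₁ (x+y≈0⇒x≈y t+1≈0))
      ...   | inj₂ t+a≈0 = inj₂ (inj₂ (x+y≈0⇒x≈y t+a≈0))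

      image-meets-conic : ∀ {h t} → OnHyperoval h → Proportional (M h) (conicPoint t) → SharedParameter a t
      image-meets-conic (on-conic z) Mh∼Pt with image-of-conic-meets-conic Mh∼Pt
      ... | inj₁ t≈0 = inj₁ t≈0
      ... | inj₂ (inj₁ t≈1) = inj₂ (inj₁ t≈1)
      ... | inj₂ (inj₂ t≈a) = inj₂ (inj₂ (inj₁ t≈a))
      image-meets-conic on-conic∞ M∞∼Pt =
        let M∞₀≈0 , _ , M∞₂≈1 = M-conicPoint∞
        in contradiction (trans (sym M∞₂≈1) (proj₂ (multiple-of-conicPoint-x₀≈0 M∞∼Pt M∞₀≈0))) 1≉0
      image-meets-conic on-nucleus MN∼Pt =
        let MN₀≈1 , MN₁≈1+a , MN₂≈a = M-nucleus
            MN₁≈t , MN₂≈t² = multiple-of-conicPoint-x₀≈1 MN∼Pt MN₀≈1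
        in inj₂ (inj₂ (inj₂ (trans (sym MN₁≈t) MN₁≈1+a , trans (sym MN₂≈t²) MN₂≈a)))

      shared⇒on-image : ∀ {t} → SharedParameter a t → ∃[ h ] (OnHyperoval h × Proportional (M h) (conicPoint t))
      shared⇒on-image (inj₁ t≈0) =
        conicPoint 0# , on-conic 0# , rescaled a
          ( solve 1 (λ a → a :* con 1 :+ con 0 := a :* con 1) refl a
          , solve 1 (λ a → (con 1 :+ a) :* con 0 := a :* con 0) refl a
          , solve 1 (λ a → a :* con 0 :+ con 0 :* con 0 := a :* (con 0 :* con 0)) refl a ) t≈0
      shared⇒on-image (inj₂ (inj₁ t≈1)) =
        conicPoint 1# , on-conic 1# , rescaled (1# + a)
          ( solve 1 (λ a → a :* con 1 :+ con 1 := (con 1 :+ a) :* con 1) refl a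
          , refl
          , solve 1 (λ a → a :* con 1 :+ con 1 :* con 1 := (con 1 :+ a) :* (con 1 :* con 1)) refl a ) t≈1
      shared⇒on-image (inj₂ (inj₂ (inj₁ t≈a))) =
        conicPoint (a * a) , on-conic (a * a) , rescaled (a + a * a)
          ( solve 1 (λ a → a :* con 1 :+ a :* a := (a :+ a :* a) :* con 1) refl a
          , solve 1 (λ a → (con 1 :+ a) :* (a :* a) := (a :+ a :* a) :* a) refl a
          , solve 1 (λ a → a :* (a :* a) :+ (a :* a) :* (a :* a) := (a :+ a :* a) :* (a :* a)) refl a ) t≈a
      shared⇒on-image (inj₂ (inj₂ (inj₂ (t≈1+a , t²≈a)))) =
        nucleus , on-nucleus , 1#
          , solve 1 (λ a → a :* con 0 :+ con 1 := con 1 :* con 1) refl a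
          , trans (*-identityʳ _) (trans (sym t≈1+a) (sym (*-identityˡ _)))
          , trans (+-identityʳ _) (trans (*-identityʳ a) (trans (sym t²≈a) (sym (*-identityˡ _))))

      nucleus-on-image : Proportional (M (conicPoint a)) nucleus
      nucleus-on-image = (1# + a) * a
        , trans (+-congʳ (*-identityʳ a)) (trans (x+x≈0 a) (sym (zeroʳ _)))
        , sym (*-identityʳ _)
        , trans (x+x≈0 _) (sym (zeroʳ _))

      module Enumeration (elements : List Carrier) (elements! : Unique elements) (∈-elements : ∀ x → x ∈≈ elements)
                         (R : List Carrier) (R! : Unique R)
                         (R-sound : ∀ {t} → t ∈≈ R → SharedParameter a t)
                         (R-complete : ∀ {t} → SharedParameter a t → t ∈≈ R) where

        hyperovalPoints : List Vec3
        hyperovalPoints = conicPoint∞ ∷ nucleus ∷ map conicPoint elements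

        unshared : List Carrier
        unshared = elements ∖ R

        points : List Vec3
        points = map M hyperovalPoints ++ map conicPoint unshared

        Figure : Pred Vec3 c
        Figure = OnHyperoval ∪ Image M OnHyperoval

        on-hyperoval : ∀ {h} → h ∈ hyperovalPoints → OnHyperoval h
        on-hyperoval (here ≡.refl) = on-conic∞
        on-hyperoval (there (here ≡.refl)) = on-nucleus
        on-hyperoval (there (there h∈)) with ∈-map⁻ conicPoint h∈
        ... | t , _ , ≡.refl = on-conic t

        on-figure : ∀ {u} → u ∈ points → Figure u
        on-figure u∈ with ∈-++⁻ (map M hyperovalPoints) u∈
        ... | inj₁ u∈image with ∈-map⁻ M u∈image
        ...   | h , h∈ , ≡.refl = inj₂ (h , on-hyperoval h∈ , ≡.refl)
        on-figure u∈ | inj₂ u∈rest with ∈-map⁻ conicPoint u∈rest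
        ...   | t , _ , ≡.refl = inj₁ (on-conic t)

        Covered : Vec3 → Set (c ⊔ ℓ)
        Covered v = ∃[ w ] (w ∈ points × Proportional w v)

        image-covered : ∀ {h} → OnHyperoval h → Covered (M h)
        image-covered (on-conic t) =
          let t' , t'∈ , t≈t' = find (∈-elements t)
          in M (conicPoint t') , ∈-++⁺ˡ (∈-map⁺ M (there (there (∈-map⁺ conicPoint t'∈))))
           , ≋⇒proportional (M-cong (conicPoint-cong (sym t≈t')))
        image-covered on-conic∞ = M conicPoint∞ , here ≡.refl , ≋⇒proportional (refl , refl , refl)
        image-covered on-nucleus = M nucleus , there (here ≡.refl) , ≋⇒proportional (refl , refl , refl)

        covered-via-image : ∀ {h v} → OnHyperoval h → Proportional (M h) v → Covered v
        covered-via-image Hh Mh∼v = let w , w∈ , w∼Mh = image-covered Hh in w , w∈ , proportional-trans w∼Mh Mh∼v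

        conic-covered : ∀ t → Covered (conicPoint t)
        conic-covered t with t ∈? R
        ... | yes t∈R = let h , Hh , Mh∼Pt = shared⇒on-image (R-sound t∈R) in covered-via-image Hh Mh∼Pt
        ... | no t∉R =
          let t' , t'∈ , t≈t' = find (∈-∖⁺ (∈-elements t) t∉R)
          in conicPoint t' , ∈-++⁺ʳ (map M hyperovalPoints) (∈-map⁺ conicPoint t'∈)
           , ≋⇒proportional (conicPoint-cong (sym t≈t'))

        figure-covered : ∀ {v} → Figure v → Covered v
        figure-covered (inj₁ (on-conic t)) = conic-covered t
        figure-covered (inj₁ on-conic∞) = covered-via-image on-conic∞ (≋⇒proportional M-conicPoint∞)
        figure-covered (inj₁ on-nucleus) = covered-via-image (on-conic a) nucleus-on-image
        figure-covered (inj₂ (h , Hh , ≡.refl)) = image-covered Hh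

        figure-nonzero : ∀ {u} → Figure u → NonZero3 u
        figure-nonzero (inj₁ Hu) = hyperoval-nonzero Hu
        figure-nonzero (inj₂ (h , Hh , ≡.refl)) = preserves-nonzero (hyperoval-nonzero Hh)

        conicPoints-distinct : ∀ {ts} → Unique ts → AllPairs _≁_ (map conicPoint ts)
        conicPoints-distinct ts! = AllPairs.map⁺ (AllPairs.map (λ t≉t' → t≉t' ∘′ conicPoint-injective) ts!)

        hyperovalPoints-distinct : AllPairs _≁_ hyperovalPoints
        hyperovalPoints-distinct =
            (conicPoint∞≁nucleus ∷ All.map⁺ (All.universal (λ _ → conicPoint∞≁conicPoint) elements))
          ∷ All.map⁺ (All.universal (λ _ → nucleus≁conicPoint) elements)
          ∷ conicPoints-distinct elements!

        image≁unshared : ∀ {u v} → u ∈ map M hyperovalPoints → v ∈ map conicPoint unshared → u ≁ v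
        image≁unshared u∈ v∈ with ∈-map⁻ M u∈ | ∈-map⁻ conicPoint v∈
        ... | h , h∈ , ≡.refl | t , t∈ , ≡.refl = λ Mh∼Pt →
          proj₂ (∈-∖⁻ elements R (Any.map reflexive t∈))
                (R-complete (image-meets-conic (on-hyperoval h∈) Mh∼Pt))

        points-distinct : AllPairs _≁_ points
        points-distinct = AllPairs.++⁺
          (AllPairs.map⁺ (AllPairs.map (λ u≁v → u≁v ∘′ reflects-proportional) hyperovalPoints-distinct))
          (conicPoints-distinct (∖-unique R elements!))
          (All.tabulate λ u∈ → All.tabulate λ v∈ → image≁unshared u∈ v∈)

        length-points : length points ≡ 2 Nat.+ length elements Nat.+ length unshared
        length-points = ≡.trans (length-++ (map M hyperovalPoints))
          (≡.cong₂ Nat._+_ (≡.trans (length-map M hyperovalPoints) (≡.cong (2 Nat.+_) (length-map conicPoint elements)))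
                        (length-map conicPoint unshared))

        untouchable-set : ∀ {n} → length points ≡ n → ∃[ S ] Untouchable {n} S
        untouchable-set length≡n = S , untouchable-of-enumeration S
            (∪-untouchable hyperoval-untouchable (image-untouchable hyperoval-untouchable))
            on-figure figure-covered
          where
            S : PointSet _
            S = record { pts = points ; size = length≡n ; nonzero = figure-nonzero ∘′ on-figure ; distinct = points-distinct }

module FiniteField {c ℓ} (F : CommutativeRing c ℓ) (isField : IsField F) {q : ℕ} (order : HasOrder F q) where
  open CommutativeRing F
  open HasOrder order
  open RingProperties ring using (-‿involutive; -0#≈0#)

  _≟_ : Decidable _≈_
  x ≟ y with enum-surjective x | enum-surjective y
  ... | i , i↦x | j , j↦y = Dec.map′ (λ { ≡.refl → trans (sym i↦x) j↦y })
                                      (λ x≈y → enum-injective i j (trans i↦x (trans x≈y (sym j↦y))))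
                                      (i Fin.≟ j)

  open IsField isField using (0≉1)
  open FieldTheory F isField _≟_
  open FiniteCounting setoid _≟_
  open SetoidMembership setoid using (_∈_; _∉_)
  open SetoidMembershipₚ using (∈-resp-≈; ∉-resp-≈; ∈-tabulate⁺; ∈-map⁻; ∉⇒All[≉])
  open UniqueSetoid setoid using (Unique)
  open SetoidSubset setoid using (_⊆_)
  open Plane F using (Untouchable)

  elements : List Carrier
  elements = tabulate enum

  elements! : Unique elements
  elements! = Uniqueₚ.tabulate⁺ setoid (λ {i} {j} → enum-injective i j)

  ∈-elements : ∀ x → x ∈ elements
  ∈-elements x = let i , i↦x = enum-surjective x in ∈-resp-≈ setoid i↦x (∈-tabulate⁺ setoid i)

  length-elements : length elements ≡ q
  length-elements = length-tabulate enum

  length-elements∖ : ∀ {R} → Unique R → length (elements ∖ R) Nat.+ length R ≡ q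
  length-elements∖ R! = ≡.trans (length-∖ elements! R! (λ {x} _ → ∈-elements x)) length-elements

  ∃? : ∀ {p} {P : Pred Carrier p} → U.Decidable P → (∀ {x y} → x ≈ y → P x → P y) → Dec (∃ P)
  ∃? P? P-resp with Any.any? P? elements
  ... | yes some = yes (Any.satisfied some)
  ... | no none = no λ (x , Px) → none (Any.map (λ x≈y → P-resp x≈y Px) (∈-elements x))

  ∃-∉ : ∀ R → length R < q → ∃[ a ] a ∉ R
  ∃-∉ R |R|<q with ∃? (_∉? R) (∉-resp-≈ setoid)
  ... | yes a∉R = a∉R
  ... | no ∄a∉R = contradiction (≡.subst (_≤ length R) length-elements (unique-⊆⇒length≤ elements! elements⊆R))
                                (ℕₚ.<⇒≱ |R|<q)
    where
      elements⊆R : elements ⊆ R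
      elements⊆R {x} _ with x ∈? R
      ... | yes x∈R = x∈R
      ... | no x∉R = contradiction (x , x∉R) ∄a∉R

  -- If 1 + 1 ≉ 0 then x ↦ −x pairs off the nonzero elements, so q − 1 would be even.
  even-order⇒characteristic-two : 2 ∣ q → 1# + 1# ≈ 0#
  even-order⇒characteristic-two 2∣q with (1# + 1#) ≟ 0#
  ... | yes 1+1≈0 = 1+1≈0
  ... | no 1+1≉0 = contradiction (∣n∧∣1+n⇒≡1 2∣|units| 2∣1+|units|) λ ()
    where
      units : List Carrier
      units = elements ∖ (0# ∷ [])
      unit≉0 : ∀ {x} → x ∈ units → ¬ x ≈ 0#
      unit≉0 {x} x∈ x≈0 = proj₂ (∈-∖⁻ elements (0# ∷ []) x∈) (here x≈0)
      -unit : ∀ {x} → x ∈ units → - x ∈ units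
      -unit {x} x∈ = ∈-∖⁺ (∈-elements (- x))
        λ { (here -x≈0) → unit≉0 x∈ (trans (sym (-‿involutive x)) (trans (-‿cong -x≈0) -0#≈0#)) }
      x≉-x : ∀ {x} → x ∈ units → ¬ x ≈ - x
      x≉-x {x} x∈ x≈-x with x*y≈0⇒x≈0⊎y≈0 {1# + 1#} {x} (trans (distribʳ x 1# 1#)
                                (trans (+-cong (*-identityˡ x) (*-identityˡ x)) (trans (+-congʳ x≈-x) (-‿inverseˡ x))))
      ... | inj₁ 1+1≈0 = 1+1≉0 1+1≈0
      ... | inj₂ x≈0 = unit≉0 x∈ x≈0
      2∣|units| : 2 ∣ length units
      2∣|units| = fixedPointFree-involution⇒2∣length -_ -‿cong (∖-unique (0# ∷ []) elements!) -unit x≉-x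
                    (λ {x} _ → -‿involutive x)
      2∣1+|units| : 2 ∣ suc (length units)
      2∣1+|units| = ≡.subst (2 ∣_) (≡.sym (≡.trans (ℕₚ.+-comm 1 (length units)) (length-elements∖ ([] ∷ [])))) 2∣q

  module _ (1+1≈0 : 1# + 1# ≈ 0#) where
    open Characteristic2 1+1≈0

    squares : List Carrier
    squares = map (λ y → y * y) elements

    square-root : ∀ x → ∃[ y ] y * y ≈ x
    square-root x with x ∈? squares
    ... | yes x∈squares = let y , _ , x≈y² = ∈-map⁻ setoid setoid x∈squares in y , sym x≈y²
    ... | no x∉squares = contradiction (unique-⊆⇒length≤ x∷squares! (λ {y} _ → ∈-elements y)) |elements|≮|x∷squares|
      where
        x∷squares! : Unique (x ∷ squares)
        x∷squares! = ∉⇒All[≉] setoid x∉squares ∷ Uniqueₚ.map⁺ setoid setoid square-injective elements!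
        |elements|≮|x∷squares| : ¬ suc (length squares) ≤ length elements
        |elements|≮|x∷squares| = ≡.subst (λ n → ¬ suc n ≤ length elements) (≡.sym (length-map _ elements)) (ℕₚ.n≮n _)

    primitiveCubeRoot-resp : ∀ {x y} → x ≈ y → PrimitiveCubeRoot x → PrimitiveCubeRoot y
    primitiveCubeRoot-resp x≈y x³≈1 = trans (+-congʳ (+-cong (*-cong (sym x≈y) (sym x≈y)) (sym x≈y))) x³≈1

    primitiveCubeRoot? : Dec (∃ PrimitiveCubeRoot)
    primitiveCubeRoot? = ∃? (λ x → (x * x + x + 1#) ≟ 0#) primitiveCubeRoot-resp

    -- Without primitive cube roots, σ splits F ∖ {0, 1} into orbits of size 3, so 3 ∣ q − 2.
    cube-root-of-unity : 3 ∣ q ∸ 1 → ∃ PrimitiveCubeRoot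
    cube-root-of-unity 3∣q-1 with primitiveCubeRoot?
    ... | yes ω = ω
    ... | no ∄ω = contradiction (∣n∧∣1+n⇒≡1 3∣|rest| 3∣1+|rest|) λ ()
      where
        rest : List Carrier
        rest = elements ∖ (0# ∷ 1# ∷ [])
        [0,1]! : Unique (0# ∷ 1# ∷ [])
        [0,1]! = (0≉1 ∷ []) ∷ [] ∷ []
        ≉0 : ∀ {x} → x ∈ rest → ¬ x ≈ 0#
        ≉0 x∈ x≈0 = proj₂ (∈-∖⁻ elements _ x∈) (here x≈0)
        ≉1 : ∀ {x} → x ∈ rest → ¬ x ≈ 1#
        ≉1 x∈ x≈1 = proj₂ (∈-∖⁻ elements _ x∈) (there (here x≈1))
        σ-∈-rest : ∀ {x} → x ∈ rest → σ x ∈ rest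
        σ-∈-rest {x} x∈ = ∈-∖⁺ (∈-elements (σ x)) λ
          { (here σx≈0) → σ≉0 (≉1 x∈) σx≈0
          ; (there (here σx≈1)) → σ≉1 (≉0 x∈) (≉1 x∈) σx≈1 }
        3∣|rest| : 3 ∣ length rest
        3∣|rest| = fixedPointFree-order3⇒3∣length σ σ-cong (∖-unique _ elements!) σ-∈-rest
          (λ {x} x∈ x≈σx → ∄ω (x , σ-fixed⇒primitiveCubeRoot (≉1 x∈) (sym x≈σx)))
          (λ x∈ → σ³≈id (≉0 x∈) (≉1 x∈))
        3∣1+|rest| : 3 ∣ suc (length rest)
        3∣1+|rest| = ≡.subst (λ n → 3 ∣ n ∸ 1)
          (≡.sym (≡.trans (ℕₚ.+-comm 2 (length rest)) (length-elements∖ [0,1]!))) 3∣q-1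

    generic-parameter : 5 ≤ q → ∃[ a ] (¬ a ≈ 0# × ¬ a ≈ 1# × ¬ PrimitiveCubeRoot a)
    generic-parameter 5≤q with primitiveCubeRoot?
    ... | no ∄ω =
      let a , a∉ = ∃-∉ (0# ∷ 1# ∷ []) (ℕₚ.≤-trans (ℕₚ.m≤m+n 3 2) 5≤q)
      in a , a∉ ∘′ here , a∉ ∘′ there ∘′ here , λ a³≈1 → ∄ω (a , a³≈1)
    ... | yes (ω , ω³≈1) =
      let a , a∉ = ∃-∉ (0# ∷ 1# ∷ ω ∷ 1# + ω ∷ []) 5≤q
      in a , a∉ ∘′ here , a∉ ∘′ there ∘′ here
       , λ a³≈1 → [ a∉ ∘′ there ∘′ there ∘′ here , a∉ ∘′ there ∘′ there ∘′ there ∘′ here ]′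
                    (primitiveCubeRoots ω³≈1 a³≈1)

    open HyperovalConstruction F isField _≟_

    doubled-hyperoval : ∀ {a} → ¬ a ≈ 0# → ¬ a ≈ 1# →
      ∀ {R} → Unique R → (∀ {t} → t ∈ R → SharedParameter a t) → (∀ {t} → SharedParameter a t → t ∈ R) →
      ∀ {d} → length R ≡ 2 Nat.+ d → ∃[ S ] Untouchable {2 Nat.* q ∸ d} S
    doubled-hyperoval {a} a≉0 a≉1 {R} R! R-sound R-complete |R|≡2+d =
      untouchable-set (doubling-size (≡.trans length-points (≡.cong (λ e → 2 Nat.+ e Nat.+ length unshared) length-elements))
                                     (≡.trans (≡.cong (length unshared Nat.+_) (≡.sym |R|≡2+d)) (length-elements∖ R!)))
      where
        open Doubling 1+1≈0 square-root a a≉0 a≉1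
        open Enumeration elements elements! ∈-elements R R! R-sound R-complete

    untouchable-via-generic-parameter : ∀ {a} → ¬ a ≈ 0# → ¬ a ≈ 1# → ¬ PrimitiveCubeRoot a →
                                        ∃[ S ] Untouchable {2 Nat.* q ∸ 1} S
    untouchable-via-generic-parameter {a} a≉0 a≉1 a∉μ₃ = doubled-hyperoval a≉0 a≉1 R! sound complete ≡.refl
      where
        R! : Unique (0# ∷ 1# ∷ a ∷ [])
        R! = (0≉1 ∷ (λ 0≈a → a≉0 (sym 0≈a)) ∷ []) ∷ ((λ 1≈a → a≉1 (sym 1≈a)) ∷ []) ∷ [] ∷ []
        sound : ∀ {t} → t ∈ 0# ∷ 1# ∷ a ∷ [] → SharedParameter a t
        sound (here t≈0) = inj₁ t≈0
        sound (there (here t≈1)) = inj₂ (inj₁ t≈1)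
        sound (there (there (here t≈a))) = inj₂ (inj₂ (inj₁ t≈a))
        complete : ∀ {t} → SharedParameter a t → t ∈ 0# ∷ 1# ∷ a ∷ []
        complete (inj₁ t≈0) = here t≈0
        complete (inj₂ (inj₁ t≈1)) = there (here t≈1)
        complete (inj₂ (inj₂ (inj₁ t≈a))) = there (there (here t≈a))
        complete (inj₂ (inj₂ (inj₂ (t≈1+a , t²≈a)))) =
          contradiction ([1+x]²≈x⇒primitiveCubeRoot (trans (*-cong (sym t≈1+a) (sym t≈1+a)) t²≈a)) a∉μ₃

    untouchable-via-cube-root : ∀ {ω} → PrimitiveCubeRoot ω → ∃[ S ] Untouchable {2 Nat.* q ∸ 2} S
    untouchable-via-cube-root {ω} ω³≈1 = doubled-hyperoval ω≉0 ω≉1 R! sound complete ≡.refl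
      where
        ω≉0 : ¬ ω ≈ 0#
        ω≉0 = primitiveCubeRoot⇒≉0 ω³≈1
        ω≉1 : ¬ ω ≈ 1#
        ω≉1 = primitiveCubeRoot⇒≉1 ω³≈1
        R! : Unique (0# ∷ 1# ∷ ω ∷ 1# + ω ∷ [])
        R! = (0≉1 ∷ (λ 0≈ω → ω≉0 (sym 0≈ω)) ∷ (λ 0≈1+ω → 1+x≉0 ω≉1 (sym 0≈1+ω)) ∷ [])
           ∷ ((λ 1≈ω → ω≉1 (sym 1≈ω)) ∷ (λ 1≈1+ω → ω≉0 (sym (+-cancelˡ-≈ refl (trans (+-identityʳ 1#) 1≈1+ω))))
              ∷ [])
           ∷ ((λ ω≈1+ω → 0≉1 (+-cancelʳ-≈ refl (trans (+-identityˡ ω) ω≈1+ω))) ∷ [])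
           ∷ [] ∷ []
        sound : ∀ {t} → t ∈ 0# ∷ 1# ∷ ω ∷ 1# + ω ∷ [] → SharedParameter ω t
        sound (here t≈0) = inj₁ t≈0
        sound (there (here t≈1)) = inj₂ (inj₁ t≈1)
        sound (there (there (here t≈ω))) = inj₂ (inj₂ (inj₁ t≈ω))
        sound (there (there (there (here t≈1+ω)))) =
          inj₂ (inj₂ (inj₂ (t≈1+ω , trans (*-cong t≈1+ω t≈1+ω) (primitiveCubeRoot⇒[1+ω]²≈ω ω³≈1))))
        complete : ∀ {t} → SharedParameter ω t → t ∈ 0# ∷ 1# ∷ ω ∷ 1# + ω ∷ []
        complete (inj₁ t≈0) = here t≈0
        complete (inj₂ (inj₁ t≈1)) = there (here t≈1)
        complete (inj₂ (inj₂ (inj₁ t≈ω))) = there (there (here t≈ω))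
        complete (inj₂ (inj₂ (inj₂ (t≈1+ω , _)))) = there (there (there (here t≈1+ω)))

  untouchable-of-size-2q-1 : 2 ∣ q → 5 ≤ q → ∃[ S ] Untouchable {2 Nat.* q ∸ 1} S
  untouchable-of-size-2q-1 2∣q 5≤q =
    let 1+1≈0 = even-order⇒characteristic-two 2∣q
        a , a≉0 , a≉1 , a∉μ₃ = generic-parameter 1+1≈0 5≤q
    in untouchable-via-generic-parameter 1+1≈0 a≉0 a≉1 a∉μ₃

  untouchable-of-size-2q-2 : 2 ∣ q → 3 ∣ q ∸ 1 → ∃[ S ] Untouchable {2 Nat.* q ∸ 2} S
  untouchable-of-size-2q-2 2∣q 3∣q-1 =
    let 1+1≈0 = even-order⇒characteristic-two 2∣q
        ω , ω³≈1 = cube-root-of-unity 1+1≈0 3∣q-1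
    in untouchable-via-cube-root 1+1≈0 ω³≈1

open Nat using (_*_)

mainTheorem2 : ∀ {c ℓ : Level} (F : CommutativeRing c ℓ) → IsField F →
    ∀ (k : ℕ) → 3 ≤ k → HasOrder F (2 ^ k) →
    (∃[ S ] Plane.Untouchable F {2 * 2 ^ k ∸ 1} S)
    × (∀ (m : ℕ) → k ≡ 2 * m → ∃[ S ] Plane.Untouchable F {2 * 2 ^ k ∸ 2} S)
mainTheorem2 F isField k 3≤k order =
  untouchable-of-size-2q-1 2∣q 5≤q , λ { m ≡.refl → untouchable-of-size-2q-2 2∣q (3∣4^m∸1 m) }
  where
    open FiniteField F isField order
    2∣q : 2 ∣ 2 ^ k
    2∣q = 2∣2^k (ℕₚ.≤-trans (s≤s z≤n) 3≤k)
    5≤q : 5 ≤ 2 ^ k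
    5≤q = ℕₚ.≤-trans (ℕₚ.m≤m+n 5 3) (ℕₚ.^-monoʳ-≤ 2 3≤k)
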